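{- Let $G$ be a digraph whose vertex set is partitioned as $V(G)=W\cup U$ with $W\cap U=\emptyset$, let $H$ be the induced subgraph of $G$ on $U$, and suppose that either $N^+_G[u]\subseteq W$ for all $u\in W$, or $N^-_G[u]\subseteq W$ for all $u\in W$. If $H$ does not allow the nSSP (respectively, does not require the nSSP), then $G$ does not allow the nSSP (respectively, does not require the nSSP).
   Context: A digraph $G$ has a finite vertex set and arc set $E(G)\subseteq V(G)\times V(G)$ (arcs $(v,v)$ are loops). $N^+_G[v]=\{u:(v,u)\in E(G)\}$, $N^-_G[v]=\{w:(w,v)\in E(G)\}$. For $G$ with vertex set $[n]$, $\mathcal M(G)$ is the set of real $n\times n$ matrices $A=(a_{ij})$ with $a_{ij}\ne0$ iff $(i,j)\in E(G)$. A real matrix $A$ has the nSSP if the only real $X$ with $A\circ X=O$ (entrywise product) and $AX^\top-X^\top A=O$ is $X=O$. $G$ requires (allows) the nSSP if every (some) $A\in\mathcal M(G)$ has the nSSP. -}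

module Defs where

open import Data.Nat using (ℕ; zero; suc)
open import Data.Fin using (Fin; zero; suc)
open import Data.Product using (Σ; _×_)
open import Data.Sum using (_⊎_)
open import Relation.Binary.PropositionalEquality using (_≡_; _≢_)
open import Relation.Binary.Structures using (IsStrictTotalOrder)
open import Algebra.Structures using (IsCommutativeRing)

-- The real numbers, axiomatised as a complete ordered field (any two
-- models are isomorphic, so quantifying over all models = working in ℝ).
record Reals : Set₁ where
  infixl 6 _+_
  infixl 7 _*_
  field
    ℝ : Set
    _+_ _*_ : ℝ → ℝ → ℝ
    -_ : ℝ → ℝ
    0ℝ 1ℝ : ℝ
    isCommutativeRing : IsCommutativeRing _≡_ _+_ _*_ -_ 0ℝ 1ℝ
    0≢1 : 0ℝ ≢ 1ℝ
    inverse : ∀ x → x ≢ 0ℝ → Σ ℝ (λ y → x * y ≡ 1ℝ)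
    _<_ : ℝ → ℝ → Set
    isStrictTotalOrder : IsStrictTotalOrder _≡_ _<_
    +-mono-< : ∀ {x y} z → x < y → (x + z) < (y + z)
    *-pos : ∀ {x y} → 0ℝ < x → 0ℝ < y → 0ℝ < (x * y)
    sup : (S : ℝ → Set) → Σ ℝ S → Σ ℝ (λ b → ∀ x → S x → (x < b ⊎ x ≡ b)) →
          Σ ℝ (λ s → (∀ x → S x → (x < s ⊎ x ≡ s)) ×
                     (∀ b → (∀ x → S x → (x < b ⊎ x ≡ b)) → (s < b ⊎ s ≡ b)))

-- A digraph on vertex set [n] = Fin n; Arc v u means (v,u) ∈ E(G) (loops allowed).
record Digraph (n : ℕ) : Set₁ where
  field
    Arc : Fin n → Fin n → Set
open Digraph public

-- Induced subgraph on the image of an (injective) labelling ι : Fin m → Fin n.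
induced : ∀ {m n} → Digraph n → (Fin m → Fin n) → Digraph m
induced G ι = record { Arc = λ i j → Arc G (ι i) (ι j) }

module RealMatrices (R : Reals) where
  open Reals R

  Matrix : ℕ → Set
  Matrix n = Fin n → Fin n → ℝ

  Σᶠ : ∀ {n} → (Fin n → ℝ) → ℝ
  Σᶠ {zero} f = 0ℝ
  Σᶠ {suc n} f = f zero + Σᶠ (λ k → f (suc k))

  _·_ : ∀ {n} → Matrix n → Matrix n → Matrix n
  (A · B) i j = Σᶠ (λ k → A i k * B k j)

  _ᵀ : ∀ {n} → Matrix n → Matrix n
  (X ᵀ) i j = X j i

  _∈𝓜_ : ∀ {n} → Matrix n → Digraph n → Set
  A ∈𝓜 G = ∀ i j → (A i j ≢ 0ℝ → Arc G i j) × (Arc G i j → A i j ≢ 0ℝ)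

  HasNSSP : ∀ {n} → Matrix n → Set
  HasNSSP {n} A = (X : Matrix n) →
    (∀ i j → A i j * X i j ≡ 0ℝ) →
    (∀ i j → (A · (X ᵀ)) i j + - ((X ᵀ) · A) i j ≡ 0ℝ) →
    ∀ i j → X i j ≡ 0ℝ

  AllowsNSSP : ∀ {n} → Digraph n → Set
  AllowsNSSP {n} G = Σ (Matrix n) (λ A → A ∈𝓜 G × HasNSSP A)

  RequiresNSSP : ∀ {n} → Digraph n → Set
  RequiresNSSP {n} G = (A : Matrix n) → A ∈𝓜 G → HasNSSP A

-- Write U for the image of ι and W for its complement. If arcs leaving W stay in W, every
-- A ∈ 𝓜(G) has A[W,U] = O. Given Y ≠ O with A[U] ∘ Y = O and A[U] Yᵀ = Yᵀ A[U], look for a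
-- matrix violating the nSSP for A of the block form (rows and columns ordered W, U)
--     X = [ O  F  ]
--         [ O  tY ]
-- Then A ∘ X = O follows from A[W,U] = O and A[U] ∘ Y = O, while AXᵀ = XᵀA reduces to the
-- Sylvester equation A[U] Fᵀ − Fᵀ A[W] = t Yᵀ A[U,W]: |U||W| homogeneous linear equations in
-- the |U||W| + 1 unknowns (t, F). A nonzero solution gives X ≠ O, whether or not t = 0.
-- If instead arcs entering W come from W, apply this to the transposes. For "requires", every
-- B ∈ 𝓜(H) is A[U] for some A ∈ 𝓜(G).

module Submission where

open import Defs
open import Data.Nat as ℕ using (ℕ; zero; suc; _≤_; s≤s)
open import Data.Nat.Properties using (≤-refl)
open import Data.Fin using (Fin; zero; suc; punchIn; punchOut; combine; remQuot)
open import Data.Fin.Properties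
  using (all?; any?; ¬∀⟶∃¬; punchIn-punchOut; punchInᵢ≢i; combine-remQuot; remQuot-combine; sequence)
  renaming (_≟_ to _≟ᶠ_)
open import Data.Vec.Functional using (_∷_)
open import Data.Product using (∃; ∃₂; _×_; _,_; proj₁; proj₂; uncurry)
open import Data.Sum using (_⊎_; inj₁; inj₂)
open import Data.Empty using (⊥-elim)
open import Level using (0ℓ)
open import Algebra.Bundles using (CommutativeRing)
open import Relation.Binary.PropositionalEquality
open import Relation.Binary.Structures using (IsStrictTotalOrder)
open import Relation.Nullary using (¬_; Dec; yes; no)
open import Relation.Nullary.Decidable using (decidable-stable; ¬¬-excluded-middle)
open import Relation.Nullary.Negation using (¬¬-Monad)
open import Effect.Monad using (RawMonad)
open import Function.Bundles using (_⇔_; mk⇔; Equivalence)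
open import Function.Definitions using (Injective)
open import Function using (_∘_)

reverse : ∀ {n} → Digraph n → Digraph n
reverse G = record { Arc = λ v u → Arc G u v }

¬¬-Arc-decidable : ∀ {n} (G : Digraph n) → ¬ ¬ (∀ v u → Dec (Arc G v u))
¬¬-Arc-decidable G = sequence ¬¬-applicative λ v → sequence ¬¬-applicative λ u → ¬¬-excluded-middle
  where open RawMonad ¬¬-Monad using () renaming (rawApplicative to ¬¬-applicative)

module _ (R : Reals) where
  open Reals R
  open RealMatrices R using (Matrix; Σᶠ; _ᵀ; _∈𝓜_; HasNSSP; AllowsNSSP; RequiresNSSP)

  commutativeRing : CommutativeRing 0ℓ 0ℓ
  commutativeRing = record { isCommutativeRing = isCommutativeRing }

  open CommutativeRing commutativeRing
    using ( semiring; ring; *-commutativeSemigroup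
          ; +-identityˡ; +-identityʳ; -‿inverseˡ
          ; *-assoc; *-comm; *-identityˡ; *-identityʳ; distribʳ; zeroˡ; zeroʳ )
  open import Algebra.Properties.Ring ring
    using (-1*x≈-x; -‿distribʳ-*; x∙y⁻¹≈ε⇒x≈y; x≈y⇒x∙y⁻¹≈ε)
  open import Algebra.Properties.CommutativeSemigroup *-commutativeSemigroup
    using () renaming (x∙yz≈y∙xz to x*yz≈y*xz)
  open import Algebra.Properties.Semiring.Sum semiring
    using (sum; sum-syntax; sum-cong-≗; sum-replicate-zero; sum-remove;
           ∑-distrib-+; ∑-comm; *-distribˡ-sum; *-distribʳ-sum)
  open ≡-Reasoning

  _≟ℝ_ : (x y : ℝ) → Dec (x ≡ y)
  _≟ℝ_ = IsStrictTotalOrder._≟_ isStrictTotalOrder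

  indicator : ∀ {P : Set} → Dec P → ℝ
  indicator (yes _) = 1ℝ
  indicator (no  _) = 0ℝ

  1≢0 : 1ℝ ≢ 0ℝ
  1≢0 1≡0 = 0≢1 (sym 1≡0)

  *-nonzero : ∀ {x y} → x ≢ 0ℝ → y ≢ 0ℝ → x * y ≢ 0ℝ
  *-nonzero {x} {y} x≢0 y≢0 xy≡0 with inverse x x≢0
  ... | x⁻¹ , xx⁻¹≡1 = y≢0 (begin
    y               ≡⟨ sym (*-identityˡ y) ⟩
    1ℝ * y          ≡⟨ cong (_* y) (trans (sym xx⁻¹≡1) (*-comm x x⁻¹)) ⟩
    (x⁻¹ * x) * y   ≡⟨ *-assoc x⁻¹ x y ⟩
    x⁻¹ * (x * y)   ≡⟨ cong (x⁻¹ *_) xy≡0 ⟩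
    x⁻¹ * 0ℝ        ≡⟨ zeroʳ x⁻¹ ⟩
    0ℝ              ∎)

  indicator≢0-iff : ∀ {P : Set} (P? : Dec P) → (indicator P? ≢ 0ℝ → P) × (P → indicator P? ≢ 0ℝ)
  indicator≢0-iff (yes p) = (λ _ → p) , (λ _ → 1≢0)
  indicator≢0-iff (no ¬p) = (λ 0≢0 → ⊥-elim (0≢0 refl)) , (λ p → ⊥-elim (¬p p))

  Σᶠ≡sum : ∀ {k} (f : Fin k → ℝ) → Σᶠ f ≡ sum f
  Σᶠ≡sum {zero}  f = refl
  Σᶠ≡sum {suc k} f = cong (f zero +_) (Σᶠ≡sum (λ l → f (suc l)))

  sum-zero : ∀ {k} {f : Fin k → ℝ} → (∀ l → f l ≡ 0ℝ) → sum f ≡ 0ℝ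
  sum-zero {k} f≡0 = trans (sum-cong-≗ f≡0) (sum-replicate-zero k)

  sum-isolated : ∀ {k} (f : Fin k → ℝ) c → (∀ l → l ≢ c → f l ≡ 0ℝ) → sum f ≡ f c
  sum-isolated {suc _} f c f≡0 = begin
    sum f                              ≡⟨ sum-remove {i = c} f ⟩
    f c + sum (λ l → f (punchIn c l))  ≡⟨ cong (f c +_) (sum-zero (λ l → f≡0 _ (punchInᵢ≢i c l))) ⟩
    f c + 0ℝ                           ≡⟨ +-identityʳ (f c) ⟩
    f c                                ∎

  δ : ∀ {k} → Fin k → Fin k → ℝ
  δ a b with a ≟ᶠ b
  ... | yes _ = 1ℝ
  ... | no  _ = 0ℝ

  δ-refl : ∀ {k} (a : Fin k) → δ a a ≡ 1ℝ
  δ-refl a with a ≟ᶠ a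
  ... | yes _  = refl
  ... | no a≢a = ⊥-elim (a≢a refl)

  δ-≢ : ∀ {k} {a b : Fin k} → a ≢ b → δ a b ≡ 0ℝ
  δ-≢ {a = a} {b} a≢b with a ≟ᶠ b
  ... | yes a≡b = ⊥-elim (a≢b a≡b)
  ... | no  _   = refl

  sum-δ : ∀ {k} (c : Fin k) (f : Fin k → ℝ) → ∑[ l < k ] (δ c l * f l) ≡ f c
  sum-δ {k} c f = begin
    ∑[ l < k ] (δ c l * f l)  ≡⟨ sum-isolated _ c (λ l l≢c → trans (cong (_* f l) (δ-≢ (l≢c ∘ sym))) (zeroˡ (f l))) ⟩
    δ c c * f c               ≡⟨ cong (_* f c) (δ-refl c) ⟩
    1ℝ * f c                  ≡⟨ *-identityˡ (f c) ⟩
    f c                       ∎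

  Form : ℕ → Set
  Form N = (Fin N → ℝ) → ℝ

  Linear : ∀ {N} → Form N → Set
  Linear {N} φ = ∃ λ (c : Fin N → ℝ) → ∀ x → φ x ≡ ∑[ l < N ] (c l * x l)

  Linear-resp : ∀ {N} {φ ψ : Form N} → (∀ x → φ x ≡ ψ x) → Linear φ → Linear ψ
  Linear-resp φ≗ψ (c , φ≡c·) = c , λ x → trans (sym (φ≗ψ x)) (φ≡c· x)

  coord-linear : ∀ {N} (l : Fin N) → Linear (λ x → x l)
  coord-linear l = δ l , λ x → sym (sum-δ l x)

  scaleˡ-linear : ∀ {N} {φ : Form N} a → Linear φ → Linear (λ x → a * φ x)
  scaleˡ-linear {N} {φ} a (c , φ≡c·) = (λ l → a * c l) , λ x → begin
    a * φ x                       ≡⟨ cong (a *_) (φ≡c· x) ⟩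
    a * ∑[ l < N ] (c l * x l)    ≡⟨ *-distribˡ-sum a (λ l → c l * x l) ⟩
    ∑[ l < N ] (a * (c l * x l))  ≡⟨ sum-cong-≗ (λ l → sym (*-assoc a (c l) (x l))) ⟩
    ∑[ l < N ] ((a * c l) * x l)  ∎

  scaleʳ-linear : ∀ {N} {φ : Form N} a → Linear φ → Linear (λ x → φ x * a)
  scaleʳ-linear a lin = Linear-resp (λ x → *-comm a _) (scaleˡ-linear a lin)

  +-linear : ∀ {N} {φ ψ : Form N} → Linear φ → Linear ψ → Linear (λ x → φ x + ψ x)
  +-linear {N} {φ} {ψ} (c , φ≡c·) (d , ψ≡d·) = (λ l → c l + d l) , λ x → begin
    φ x + ψ x                                        ≡⟨ cong₂ _+_ (φ≡c· x) (ψ≡d· x) ⟩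
    ∑[ l < N ] (c l * x l) + ∑[ l < N ] (d l * x l)  ≡⟨ sym (∑-distrib-+ (λ l → c l * x l) (λ l → d l * x l)) ⟩
    ∑[ l < N ] (c l * x l + d l * x l)               ≡⟨ sum-cong-≗ (λ l → sym (distribʳ (x l) (c l) (d l))) ⟩
    ∑[ l < N ] ((c l + d l) * x l)                   ∎

  -‿linear : ∀ {N} {φ : Form N} → Linear φ → Linear (λ x → - φ x)
  -‿linear lin = Linear-resp (λ x → -1*x≈-x _) (scaleˡ-linear (- 1ℝ) lin)

  ∑-linear : ∀ {K N} {φ : Fin K → Form N} → (∀ k → Linear (φ k)) → Linear (λ x → ∑[ k < K ] (φ k x))
  ∑-linear {K} {N} {φ} lin = (λ l → ∑[ k < K ] c k l) , λ x → begin
    ∑[ k < K ] (φ k x)                     ≡⟨ sum-cong-≗ (λ k → proj₂ (lin k) x) ⟩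
    ∑[ k < K ] ∑[ l < N ] (c k l * x l)    ≡⟨ ∑-comm (λ k l → c k l * x l) ⟩
    ∑[ l < N ] ∑[ k < K ] (c k l * x l)    ≡⟨ sum-cong-≗ (λ l → sym (*-distribʳ-sum (x l) (λ k → c k l))) ⟩
    ∑[ l < N ] ((∑[ k < K ] c k l) * x l)  ∎
    where
    c : Fin K → Fin N → ℝ
    c k = proj₁ (lin k)

  e₀ : ∀ {N} → Fin (suc N) → ℝ
  e₀ = 1ℝ ∷ λ _ → 0ℝ

  zero∷-linear : ∀ {N} {φ : Form (suc N)} → Linear φ → Linear (λ y → φ (0ℝ ∷ y))
  zero∷-linear {N} {φ} (c , φ≡c·) = (λ l → c (suc l)) , λ y → begin
    φ (0ℝ ∷ y)                                   ≡⟨ φ≡c· (0ℝ ∷ y) ⟩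
    c zero * 0ℝ + ∑[ l < N ] (c (suc l) * y l)   ≡⟨ cong (_+ ∑[ l < N ] (c (suc l) * y l)) (zeroʳ (c zero)) ⟩
    0ℝ + ∑[ l < N ] (c (suc l) * y l)            ≡⟨ +-identityˡ _ ⟩
    ∑[ l < N ] (c (suc l) * y l)                 ∎

  linear-∷ : ∀ {N} {φ : Form (suc N)} → Linear φ → ∀ a y → φ (a ∷ y) ≡ φ e₀ * a + φ (0ℝ ∷ y)
  linear-∷ {N} {φ} (c , φ≡c·) a y = begin
    φ (a ∷ y)                                  ≡⟨ φ≡c· (a ∷ y) ⟩
    c zero * a + ∑[ l < N ] (c (suc l) * y l)  ≡⟨ cong₂ _+_ (cong (_* a) (sym φe₀≡c₀)) (sym (proj₂ (zero∷-linear (c , φ≡c·)) y)) ⟩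
    φ e₀ * a + φ (0ℝ ∷ y)                      ∎
    where
    φe₀≡c₀ : φ e₀ ≡ c zero
    φe₀≡c₀ = begin
      φ e₀                                       ≡⟨ φ≡c· e₀ ⟩
      c zero * 1ℝ + ∑[ l < N ] (c (suc l) * 0ℝ)  ≡⟨ cong₂ _+_ (*-identityʳ (c zero)) (sum-zero (λ l → zeroʳ (c (suc l)))) ⟩
      c zero + 0ℝ                                ≡⟨ +-identityʳ (c zero) ⟩
      c zero                                     ∎

  Nonzero : ∀ {N} → (Fin N → ℝ) → Set
  Nonzero x = ∃ λ l → x l ≢ 0ℝ

  module Pivot {k N} (φ : Fin (suc k) → Form (suc (suc N))) (lin : ∀ r → Linear (φ r))
               (p : Fin (suc k)) (φₚe₀≢0 : φ p e₀ ≢ 0ℝ) where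

    inv : ℝ
    inv = proj₁ (inverse (φ p e₀) φₚe₀≢0)

    -- The point with tail y on the hyperplane φ p = 0; this eliminates the first unknown.
    lift : (Fin (suc N) → ℝ) → Fin (suc (suc N)) → ℝ
    lift y = - (inv * φ p (0ℝ ∷ y)) ∷ y

    lift-linear : ∀ r → Linear (λ y → φ r (lift y))
    lift-linear r = Linear-resp (λ y → sym (linear-∷ (lin r) _ y))
      (+-linear (scaleˡ-linear (φ r e₀) (-‿linear (scaleˡ-linear inv (zero∷-linear (lin p)))))
                (zero∷-linear (lin r)))

    φₚ∘lift≡0 : ∀ y → φ p (lift y) ≡ 0ℝ
    φₚ∘lift≡0 y = begin
      φ p (lift y)                ≡⟨ linear-∷ (lin p) _ y ⟩
      φ p e₀ * - (inv * s) + s    ≡⟨ cong (_+ s) (sym (-‿distribʳ-* (φ p e₀) (inv * s))) ⟩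
      - (φ p e₀ * (inv * s)) + s  ≡⟨ cong (λ z → - z + s) (sym (*-assoc (φ p e₀) inv s)) ⟩
      - ((φ p e₀ * inv) * s) + s  ≡⟨ cong (λ z → - (z * s) + s) (proj₂ (inverse (φ p e₀) φₚe₀≢0)) ⟩
      - (1ℝ * s) + s              ≡⟨ cong (λ z → - z + s) (*-identityˡ s) ⟩
      - s + s                     ≡⟨ -‿inverseˡ s ⟩
      0ℝ                          ∎
      where
      s : ℝ
      s = φ p (0ℝ ∷ y)

    reduced : Fin k → Form (suc N)
    reduced r y = φ (punchIn p r) (lift y)

    lift-solves : ∀ {y} → (∀ r → reduced r y ≡ 0ℝ) → ∀ r → φ r (lift y) ≡ 0ℝ
    lift-solves {y} sol r with p ≟ᶠ r
    ... | yes refl = φₚ∘lift≡0 y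
    ... | no  p≢r  = subst (λ r′ → φ r′ (lift y) ≡ 0ℝ) (punchIn-punchOut p≢r) (sol (punchOut p≢r))

  underdetermined⇒nonzero-solution : ∀ {k N} (φ : Fin k → Form (suc N)) → (∀ r → Linear (φ r)) →
                                     k ≤ N → ∃ λ x → Nonzero x × ∀ r → φ r x ≡ 0ℝ
  underdetermined⇒nonzero-solution {zero} _ _ _ = e₀ , (zero , 1≢0) , λ ()
  underdetermined⇒nonzero-solution {suc k} {suc N} φ lin (s≤s k≤N) with all? (λ r → φ r e₀ ≟ℝ 0ℝ)
  ... | yes φe₀≡0 = e₀ , (zero , 1≢0) , φe₀≡0
  ... | no  ¬φe₀≡0 with p , φₚe₀≢0 ← ¬∀⟶∃¬ _ _ (λ r → φ r e₀ ≟ℝ 0ℝ) ¬φe₀≡0 =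
    let open Pivot φ lin p φₚe₀≢0
        y , (l , yₗ≢0) , sol =
          underdetermined⇒nonzero-solution reduced (λ r → lift-linear (punchIn p r)) k≤N
    in  lift y , (suc l , yₗ≢0) , lift-solves sol

  SolvesNSSP : ∀ {n} → Matrix n → Matrix n → Set
  SolvesNSSP {n} A X = (∀ i j → A i j * X i j ≡ 0ℝ) ×
                       (∀ i j → ∑[ k < n ] (A i k * X j k) ≡ ∑[ k < n ] (X k i * A k j))

  Σᶠ-difference≡0⇔sum≡ : ∀ {n} (f g : Fin n → ℝ) → (Σᶠ f + - Σᶠ g ≡ 0ℝ) ⇔ (sum f ≡ sum g)
  Σᶠ-difference≡0⇔sum≡ f g = mk⇔
    (λ f-g≡0 → x∙y⁻¹≈ε⇒x≈y _ _ (subst₂ (λ a b → a + - b ≡ 0ℝ) (Σᶠ≡sum f) (Σᶠ≡sum g) f-g≡0))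
    (λ f≡g → subst₂ (λ a b → a + - b ≡ 0ℝ) (sym (Σᶠ≡sum f)) (sym (Σᶠ≡sum g)) (x≈y⇒x∙y⁻¹≈ε f≡g))

  HasNSSP-intro : ∀ {n} {A : Matrix n} → (∀ X → SolvesNSSP A X → ∀ i j → X i j ≡ 0ℝ) → HasNSSP A
  HasNSSP-intro {A = A} nssp X A∘X≡0 [A,Xᵀ]≡0 = nssp X (A∘X≡0 , λ i j →
    Equivalence.to (Σᶠ-difference≡0⇔sum≡ (λ k → A i k * X j k) (λ k → X k i * A k j)) ([A,Xᵀ]≡0 i j))

  HasNSSP-elim : ∀ {n} {A X : Matrix n} → HasNSSP A → SolvesNSSP A X → ∀ i j → X i j ≡ 0ℝ
  HasNSSP-elim {A = A} {X} nssp (A∘X≡0 , commutes) = nssp X A∘X≡0 λ i j →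
    Equivalence.from (Σᶠ-difference≡0⇔sum≡ (λ k → A i k * X j k) (λ k → X k i * A k j)) (commutes i j)

  SolvesNSSP-ᵀ : ∀ {n} {A X : Matrix n} → SolvesNSSP A X → SolvesNSSP (A ᵀ) (X ᵀ)
  SolvesNSSP-ᵀ {n} {A} {X} (A∘X≡0 , commutes) = (λ i j → A∘X≡0 j i) , λ i j → begin
    ∑[ k < n ] (A k i * X k j)   ≡⟨ sum-cong-≗ (λ k → *-comm (A k i) (X k j)) ⟩
    ∑[ k < n ] (X k j * A k i)   ≡⟨ sym (commutes j i) ⟩
    ∑[ k < n ] (A j k * X i k)   ≡⟨ sum-cong-≗ (λ k → *-comm (A j k) (X i k)) ⟩
    ∑[ k < n ] (X i k * A j k)   ∎

  HasNSSP-ᵀ : ∀ {n} {A : Matrix n} → HasNSSP A → HasNSSP (A ᵀ)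
  HasNSSP-ᵀ nssp = HasNSSP-intro λ X solves i j → HasNSSP-elim nssp (SolvesNSSP-ᵀ solves) j i

  HasNSSP-cong : ∀ {n} {A B : Matrix n} → (∀ i j → A i j ≡ B i j) → HasNSSP A → HasNSSP B
  HasNSSP-cong {n} {A} {B} A≗B nssp = HasNSSP-intro λ X (B∘X≡0 , commutes) → HasNSSP-elim nssp
    ( (λ i j → trans (cong (_* X i j) (A≗B i j)) (B∘X≡0 i j))
    , λ i j → begin
        ∑[ k < n ] (A i k * X j k)   ≡⟨ sum-cong-≗ (λ k → cong (_* X j k) (A≗B i k)) ⟩
        ∑[ k < n ] (B i k * X j k)   ≡⟨ commutes i j ⟩
        ∑[ k < n ] (X k i * B k j)   ≡⟨ sum-cong-≗ (λ k → cong (X k i *_) (sym (A≗B k j))) ⟩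
        ∑[ k < n ] (X k i * A k j)   ∎ )

  module Embedding {m n} (ι : Fin m → Fin n) (ι-inj : Injective _≡_ _≡_ ι) where

    -- Outside v means v ∈ W.
    Outside : Fin n → Set
    Outside v = ∀ j → ι j ≢ v

    side : ∀ v → (∃ λ j → ι j ≡ v) ⊎ Outside v
    side v with any? (λ j → ι j ≟ᶠ v)
    ... | yes inside  = inj₁ inside
    ... | no  ¬inside = inj₂ (λ j ιj≡v → ¬inside (j , ιj≡v))

    restrict : Matrix n → Matrix m
    restrict A i j = A (ι i) (ι j)

    extend : (Fin m → ℝ) → Fin n → ℝ
    extend f v = ∑[ j < m ] (δ (ι j) v * f j)

    extend-ι : ∀ f i → extend f (ι i) ≡ f i
    extend-ι f i = begin
      ∑[ j < m ] (δ (ι j) (ι i) * f j)   ≡⟨ sum-isolated _ i (λ j j≢i → trans (cong (_* f j) (δ-≢ (j≢i ∘ ι-inj))) (zeroˡ (f j))) ⟩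
      δ (ι i) (ι i) * f i                ≡⟨ cong (_* f i) (δ-refl (ι i)) ⟩
      1ℝ * f i                           ≡⟨ *-identityˡ (f i) ⟩
      f i                                ∎

    extend-outside : ∀ f {v} → Outside v → extend f v ≡ 0ℝ
    extend-outside f out = sum-zero (λ j → trans (cong (_* f j) (δ-≢ (out j))) (zeroˡ (f j)))

    ∑-extend : ∀ (g : Fin n → ℝ) f → ∑[ v < n ] (g v * extend f v) ≡ ∑[ j < m ] (g (ι j) * f j)
    ∑-extend g f = begin
      ∑[ v < n ] (g v * extend f v)                    ≡⟨ sum-cong-≗ (λ v → *-distribˡ-sum (g v) (λ j → δ (ι j) v * f j)) ⟩
      ∑[ v < n ] ∑[ j < m ] (g v * (δ (ι j) v * f j))  ≡⟨ ∑-comm (λ v j → g v * (δ (ι j) v * f j)) ⟩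
      ∑[ j < m ] ∑[ v < n ] (g v * (δ (ι j) v * f j))  ≡⟨ sum-cong-≗ (λ j → sum-cong-≗ (λ v → x*yz≈y*xz (g v) (δ (ι j) v) (f j))) ⟩
      ∑[ j < m ] ∑[ v < n ] (δ (ι j) v * (g v * f j))  ≡⟨ sum-cong-≗ (λ j → sum-δ (ι j) (λ v → g v * f j)) ⟩
      ∑[ j < m ] (g (ι j) * f j)                       ∎

    record SylvesterSolution (A : Matrix n) (S : Fin n → Fin m → ℝ) : Set where
      field
        t         : ℝ
        F         : Fin n → Fin m → ℝ
        nonzero   : t ≢ 0ℝ ⊎ ∃₂ λ v j → F v j ≢ 0ℝ
        F-inside  : ∀ i j → F (ι i) j ≡ 0ℝ
        F-outside : ∀ b → Outside b → ∀ i →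
                    ∑[ j < m ] (A (ι i) (ι j) * F b j) ≡ ∑[ v < n ] (F v i * A v b) + t * S b i

    -- F is indexed by all of Fin n, and its rows in U are forced to vanish by extra equations:
    -- this gives n·m equations in n·m + 1 unknowns without having to enumerate W.
    module SylvesterSystem (A : Matrix n) (S : Fin n → Fin m → ℝ) where

      Unknowns : Set
      Unknowns = Fin (suc (n ℕ.* m)) → ℝ

      blockPart : Unknowns → Fin n → Fin m → ℝ
      blockPart x v j = x (suc (combine v j))

      sylvester : Fin n → Fin m → Form (suc (n ℕ.* m))
      sylvester b i x = ∑[ j < m ] (A (ι i) (ι j) * blockPart x b j)
                      + - (∑[ v < n ] (blockPart x v i * A v b) + x zero * S b i)

      sylvester-linear : ∀ b i → Linear (sylvester b i)
      sylvester-linear b i =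
        +-linear (∑-linear λ j → scaleˡ-linear (A (ι i) (ι j)) (coord-linear (suc (combine b j))))
                 (-‿linear (+-linear (∑-linear λ v → scaleʳ-linear (A v b) (coord-linear (suc (combine v i))))
                                     (scaleʳ-linear (S b i) (coord-linear zero))))

      equation : Fin n → Fin m → Form (suc (n ℕ.* m))
      equation b i with side b
      ... | inj₁ _ = λ x → blockPart x b i
      ... | inj₂ _ = sylvester b i

      equation-linear : ∀ b i → Linear (equation b i)
      equation-linear b i with side b
      ... | inj₁ _ = coord-linear _
      ... | inj₂ _ = sylvester-linear b i

      solution : ∃ λ x → Nonzero x × ∀ r → uncurry equation (remQuot m r) x ≡ 0ℝ
      solution = underdetermined⇒nonzero-solution (λ r → uncurry equation (remQuot m r))
                   (λ r → uncurry equation-linear (remQuot m r)) ≤-refl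

      x : Unknowns
      x = proj₁ solution

      solves : ∀ b i → equation b i x ≡ 0ℝ
      solves b i = subst (λ bi → uncurry equation bi x ≡ 0ℝ) (remQuot-combine b i)
                         (proj₂ (proj₂ solution) (combine b i))

      nonzero : x zero ≢ 0ℝ ⊎ ∃₂ λ v j → blockPart x v j ≢ 0ℝ
      nonzero with proj₁ (proj₂ solution)
      ... | zero  , x₀≢0 = inj₁ x₀≢0
      ... | suc l , xₗ≢0 = inj₂ (proj₁ vj , proj₂ vj , λ F≡0 →
                             xₗ≢0 (trans (cong (x ∘ suc) (sym (combine-remQuot {n} m l))) F≡0))
        where
        vj : Fin n × Fin m
        vj = remQuot {n} m l

      F-inside : ∀ i j → blockPart x (ι i) j ≡ 0ℝ
      F-inside i j with side (ι i) | solves (ι i) j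
      ... | inj₁ _   | F≡0 = F≡0
      ... | inj₂ out | _   = ⊥-elim (out i refl)

      F-outside : ∀ b → Outside b → ∀ i →
                  ∑[ j < m ] (A (ι i) (ι j) * blockPart x b j) ≡ ∑[ v < n ] (blockPart x v i * A v b) + x zero * S b i
      F-outside b out i with side b | solves b i
      ... | inj₁ (j , ιj≡b) | _           = ⊥-elim (out j ιj≡b)
      ... | inj₂ _          | sylvester≡0 = x∙y⁻¹≈ε⇒x≈y _ _ sylvester≡0

    sylvester-solvable : ∀ A S → SylvesterSolution A S
    sylvester-solvable A S = record
      { t = x zero ; F = blockPart x ; nonzero = nonzero ; F-inside = F-inside ; F-outside = F-outside }
      where open SylvesterSystem A S

    module BlockTriangular (A : Matrix n) (A-WU≡0 : ∀ w → Outside w → ∀ i → A w (ι i) ≡ 0ℝ) where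

      module Witness (Y : Matrix m) (Y-solves : SolvesNSSP (restrict A) Y) where

        -- S b i is the (i, b) entry of Yᵀ A[U,·], the right-hand side of the Sylvester equation.
        S : Fin n → Fin m → ℝ
        S b i = ∑[ i′ < m ] (A (ι i′) b * Y i′ i)

        open SylvesterSolution (sylvester-solvable A S)

        row : Fin n → Fin m → ℝ
        row v j = F v j + t * extend (λ i → Y i j) v

        X : Matrix n
        X v u = extend (row v) u

        row-inside : ∀ i j → row (ι i) j ≡ t * Y i j
        row-inside i j = begin
          F (ι i) j + t * extend (λ i′ → Y i′ j) (ι i)  ≡⟨ cong₂ (λ f y → f + t * y) (F-inside i j) (extend-ι (λ i′ → Y i′ j) i) ⟩
          0ℝ + t * Y i j                                 ≡⟨ +-identityˡ (t * Y i j) ⟩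
          t * Y i j                                      ∎

        row-outside : ∀ {v} → Outside v → ∀ j → row v j ≡ F v j
        row-outside {v} out j = begin
          F v j + t * extend (λ i → Y i j) v  ≡⟨ cong (λ y → F v j + t * y) (extend-outside (λ i → Y i j) out) ⟩
          F v j + t * 0ℝ                      ≡⟨ cong (F v j +_) (zeroʳ t) ⟩
          F v j + 0ℝ                          ≡⟨ +-identityʳ (F v j) ⟩
          F v j                               ∎

        X-annihilated : ∀ v u → A v u * X v u ≡ 0ℝ
        X-annihilated v u with side u | side v
        ... | inj₂ u-out      | _               = trans (cong (A v u *_) (extend-outside (row v) u-out)) (zeroʳ _)
        ... | inj₁ (j , refl) | inj₂ v-out      = trans (cong (_* X v (ι j)) (A-WU≡0 v v-out j)) (zeroˡ _)
        ... | inj₁ (j , refl) | inj₁ (i , refl) = begin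
          A (ι i) (ι j) * X (ι i) (ι j)   ≡⟨ cong (A (ι i) (ι j) *_) (trans (extend-ι (row (ι i)) j) (row-inside i j)) ⟩
          A (ι i) (ι j) * (t * Y i j)     ≡⟨ x*yz≈y*xz (A (ι i) (ι j)) t (Y i j) ⟩
          t * (A (ι i) (ι j) * Y i j)     ≡⟨ cong (t *_) (proj₁ Y-solves i j) ⟩
          t * 0ℝ                          ≡⟨ zeroʳ t ⟩
          0ℝ                              ∎

        Xᵀ-A-inside : ∀ i b → ∑[ k < n ] (X k (ι i) * A k b) ≡ ∑[ k < n ] (F k i * A k b) + t * S b i
        Xᵀ-A-inside i b = begin
          ∑[ k < n ] (X k (ι i) * A k b)                       ≡⟨ sum-cong-≗ split ⟩
          ∑[ k < n ] (F k i * A k b + t * (A k b * Ỹ k))       ≡⟨ ∑-distrib-+ (λ k → F k i * A k b) (λ k → t * (A k b * Ỹ k)) ⟩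
          ∑[ k < n ] (F k i * A k b) + ∑[ k < n ] (t * (A k b * Ỹ k))
            ≡⟨ cong (∑[ k < n ] (F k i * A k b) +_) (sym (*-distribˡ-sum t (λ k → A k b * Ỹ k))) ⟩
          ∑[ k < n ] (F k i * A k b) + t * ∑[ k < n ] (A k b * Ỹ k)
            ≡⟨ cong (λ s → ∑[ k < n ] (F k i * A k b) + t * s) (∑-extend (λ k → A k b) (λ i′ → Y i′ i)) ⟩
          ∑[ k < n ] (F k i * A k b) + t * S b i               ∎
          where
          Ỹ : Fin n → ℝ
          Ỹ = extend (λ i′ → Y i′ i)
          split : ∀ k → X k (ι i) * A k b ≡ F k i * A k b + t * (A k b * Ỹ k)
          split k = begin
            X k (ι i) * A k b                    ≡⟨ cong (_* A k b) (extend-ι (row k) i) ⟩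
            (F k i + t * Ỹ k) * A k b            ≡⟨ distribʳ (A k b) (F k i) (t * Ỹ k) ⟩
            F k i * A k b + (t * Ỹ k) * A k b    ≡⟨ cong (F k i * A k b +_) (trans (*-assoc t (Ỹ k) (A k b)) (cong (t *_) (*-comm (Ỹ k) (A k b)))) ⟩
            F k i * A k b + t * (A k b * Ỹ k)    ∎

        F-A-inside≡0 : ∀ i i₂ → ∑[ k < n ] (F k i * A k (ι i₂)) ≡ 0ℝ
        F-A-inside≡0 i i₂ = sum-zero term
          where
          term : ∀ k → F k i * A k (ι i₂) ≡ 0ℝ
          term k with side k
          ... | inj₁ (i′ , refl) = trans (cong (_* A (ι i′) (ι i₂)) (F-inside i′ i)) (zeroˡ _)
          ... | inj₂ k-out       = trans (cong (F k i *_) (A-WU≡0 k k-out i₂)) (zeroʳ _)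

        commutes-outside : ∀ {a} → Outside a → ∀ b →
                           ∑[ j < m ] (A a (ι j) * row b j) ≡ ∑[ k < n ] (X k a * A k b)
        commutes-outside {a} a-out b = begin
          ∑[ j < m ] (A a (ι j) * row b j)   ≡⟨ sum-zero (λ j → trans (cong (_* row b j) (A-WU≡0 a a-out j)) (zeroˡ _)) ⟩
          0ℝ                                 ≡⟨ sym (sum-zero (λ k → trans (cong (_* A k b) (extend-outside (row k) a-out)) (zeroˡ _))) ⟩
          ∑[ k < n ] (X k a * A k b)         ∎

        commutes-inside-outside : ∀ i {b} → Outside b →
                                  ∑[ j < m ] (A (ι i) (ι j) * row b j) ≡ ∑[ k < n ] (X k (ι i) * A k b)
        commutes-inside-outside i {b} b-out = begin
          ∑[ j < m ] (A (ι i) (ι j) * row b j)   ≡⟨ sum-cong-≗ (λ j → cong (A (ι i) (ι j) *_) (row-outside b-out j)) ⟩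
          ∑[ j < m ] (A (ι i) (ι j) * F b j)     ≡⟨ F-outside b b-out i ⟩
          ∑[ k < n ] (F k i * A k b) + t * S b i ≡⟨ sym (Xᵀ-A-inside i b) ⟩
          ∑[ k < n ] (X k (ι i) * A k b)         ∎

        commutes-inside-inside : ∀ i i₂ →
                                 ∑[ j < m ] (A (ι i) (ι j) * row (ι i₂) j) ≡ ∑[ k < n ] (X k (ι i) * A k (ι i₂))
        commutes-inside-inside i i₂ = begin
          ∑[ j < m ] (A (ι i) (ι j) * row (ι i₂) j)         ≡⟨ sum-cong-≗ (λ j → cong (A (ι i) (ι j) *_) (row-inside i₂ j)) ⟩
          ∑[ j < m ] (A (ι i) (ι j) * (t * Y i₂ j))         ≡⟨ sum-cong-≗ (λ j → x*yz≈y*xz (A (ι i) (ι j)) t (Y i₂ j)) ⟩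
          ∑[ j < m ] (t * (A (ι i) (ι j) * Y i₂ j))         ≡⟨ sym (*-distribˡ-sum t (λ j → A (ι i) (ι j) * Y i₂ j)) ⟩
          t * ∑[ j < m ] (A (ι i) (ι j) * Y i₂ j)           ≡⟨ cong (t *_) (proj₂ Y-solves i i₂) ⟩
          t * ∑[ k < m ] (Y k i * A (ι k) (ι i₂))           ≡⟨ cong (t *_) (sum-cong-≗ (λ k → *-comm (Y k i) (A (ι k) (ι i₂)))) ⟩
          t * S (ι i₂) i                                    ≡⟨ sym (+-identityˡ _) ⟩
          0ℝ + t * S (ι i₂) i                               ≡⟨ cong (_+ t * S (ι i₂) i) (sym (F-A-inside≡0 i i₂)) ⟩
          ∑[ k < n ] (F k i * A k (ι i₂)) + t * S (ι i₂) i  ≡⟨ sym (Xᵀ-A-inside i (ι i₂)) ⟩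
          ∑[ k < n ] (X k (ι i) * A k (ι i₂))               ∎

        X-solves : SolvesNSSP A X
        X-solves = X-annihilated , λ a b → trans (∑-extend (A a) (row b)) (commutes a b (side a) (side b))
          where
          commutes : ∀ a b → (∃ λ i → ι i ≡ a) ⊎ Outside a → (∃ λ i → ι i ≡ b) ⊎ Outside b →
                     ∑[ j < m ] (A a (ι j) * row b j) ≡ ∑[ k < n ] (X k a * A k b)
          commutes a b (inj₂ a-out)      _                  = commutes-outside a-out b
          commutes _ b (inj₁ (i , refl)) (inj₂ b-out)       = commutes-inside-outside i b-out
          commutes _ _ (inj₁ (i , refl)) (inj₁ (i₂ , refl)) = commutes-inside-inside i i₂

        X-nonzero : ∀ i j → Y i j ≢ 0ℝ → ∃₂ λ v u → X v u ≢ 0ℝ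
        X-nonzero i j Yᵢⱼ≢0 with nonzero
        ... | inj₁ t≢0 = ι i , ι j , λ X≡0 →
          *-nonzero t≢0 Yᵢⱼ≢0 (trans (sym (trans (extend-ι (row (ι i)) j) (row-inside i j))) X≡0)
        ... | inj₂ (v , j′ , F≢0) with side v
        ...   | inj₁ (i′ , refl) = ⊥-elim (F≢0 (F-inside i′ j′))
        ...   | inj₂ v-out       = v , ι j′ , λ X≡0 →
          F≢0 (trans (sym (trans (extend-ι (row v) j′) (row-outside v-out j′))) X≡0)

      HasNSSP-restrict : HasNSSP A → HasNSSP (restrict A)
      HasNSSP-restrict nssp = HasNSSP-intro λ Y Y-solves i j → decidable-stable (Y i j ≟ℝ 0ℝ) λ Yᵢⱼ≢0 →
        let open Witness Y Y-solves
            v , u , Xᵥᵤ≢0 = X-nonzero i j Yᵢⱼ≢0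
        in  Xᵥᵤ≢0 (HasNSSP-elim nssp X-solves v u)

    OutClosed : Digraph n → Set
    OutClosed G = ∀ w → Outside w → ∀ v → Arc G w v → Outside v

    ∈𝓜⇒block-zero : ∀ {G A} → A ∈𝓜 G → OutClosed G → ∀ w → Outside w → ∀ i → A w (ι i) ≡ 0ℝ
    ∈𝓜⇒block-zero {A = A} A∈𝓜G closed w w-out i = decidable-stable (A w (ι i) ≟ℝ 0ℝ) λ A≢0 →
      closed w w-out (ι i) (proj₁ (A∈𝓜G w (ι i)) A≢0) i refl

    HasNSSP-restrict-closed : ∀ {G A} → A ∈𝓜 G → OutClosed G ⊎ OutClosed (reverse G) →
                              HasNSSP A → HasNSSP (restrict A)
    HasNSSP-restrict-closed {A = A} A∈𝓜G (inj₁ closed) =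
      BlockTriangular.HasNSSP-restrict A (∈𝓜⇒block-zero A∈𝓜G closed)
    HasNSSP-restrict-closed {G} {A} A∈𝓜G (inj₂ closed) nssp = HasNSSP-ᵀ
      (BlockTriangular.HasNSSP-restrict (A ᵀ) (∈𝓜⇒block-zero {reverse G} (λ v u → A∈𝓜G u v) closed)
                                       (HasNSSP-ᵀ nssp))

    module Extension (G : Digraph n) (arc? : ∀ v u → Dec (Arc G v u)) (B : Matrix m) where

      A : Matrix n
      A v u with side v | side u
      ... | inj₁ (i , _) | inj₁ (j , _) = B i j
      ... | _            | _            = indicator (arc? v u)

      A∈𝓜G : B ∈𝓜 induced G ι → A ∈𝓜 G
      A∈𝓜G B∈𝓜H v u with side v | side u
      ... | inj₁ (i , refl) | inj₁ (j , refl) = B∈𝓜H i j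
      ... | inj₁ _          | inj₂ _          = indicator≢0-iff (arc? v u)
      ... | inj₂ _          | _               = indicator≢0-iff (arc? v u)

      restrict-A : ∀ i j → restrict A i j ≡ B i j
      restrict-A i j with side (ι i) | side (ι j)
      ... | inj₁ (i′ , ιi′≡ιi) | inj₁ (j′ , ιj′≡ιj) = cong₂ B (ι-inj ιi′≡ιi) (ι-inj ιj′≡ιj)
      ... | inj₁ _             | inj₂ ιj-out        = ⊥-elim (ιj-out j refl)
      ... | inj₂ ιi-out        | _                  = ⊥-elim (ιi-out i refl)

    ¬AllowsNSSP-lift : ∀ G → OutClosed G ⊎ OutClosed (reverse G) →
                       ¬ AllowsNSSP (induced G ι) → ¬ AllowsNSSP G
    ¬AllowsNSSP-lift G closed ¬allows (A , A∈𝓜G , nssp) =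
      ¬allows (restrict A , (λ i j → A∈𝓜G (ι i) (ι j)) , HasNSSP-restrict-closed A∈𝓜G closed nssp)

    RequiresNSSP-induced : ∀ G → (∀ v u → Dec (Arc G v u)) → OutClosed G ⊎ OutClosed (reverse G) →
                           RequiresNSSP G → RequiresNSSP (induced G ι)
    RequiresNSSP-induced G arc? closed requires B B∈𝓜H =
      HasNSSP-cong restrict-A (HasNSSP-restrict-closed (A∈𝓜G B∈𝓜H) closed (requires A (A∈𝓜G B∈𝓜H)))
      where open Extension G arc? B

    -- Arc G need not be decidable, but the goal is a negation, so we may assume it is.
    ¬RequiresNSSP-lift : ∀ G → OutClosed G ⊎ OutClosed (reverse G) →
                         ¬ RequiresNSSP (induced G ι) → ¬ RequiresNSSP G
    ¬RequiresNSSP-lift G closed ¬requires requires =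
      ¬¬-Arc-decidable G λ arc? → ¬requires (RequiresNSSP-induced G arc? closed requires)

corollary2p3 : (R : Reals) → let open RealMatrices R in
  ∀ {m n} (G : Digraph n) (ι : Fin m → Fin n) → Injective _≡_ _≡_ ι →
  let InW = λ (v : Fin n) → ∀ i → ι i ≢ v
      H = induced G ι
  in ((∀ w → InW w → ∀ v → Arc G w v → InW v)
       ⊎ (∀ w → InW w → ∀ v → Arc G v w → InW v)) →
     (¬ AllowsNSSP H → ¬ AllowsNSSP G) × (¬ RequiresNSSP H → ¬ RequiresNSSP G)
corollary2p3 R G ι ι-inj closed = ¬AllowsNSSP-lift G closed , ¬RequiresNSSP-lift G closed
  where open Embedding R ι ι-inj
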